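{- (Fusion Theorem) For positive integers $t,m,s,v,\lambda$ with $2\le t\le ms$, $OCAN_{\lambda}(t,m,s,v)\le OCAN_{\lambda}(t,m,s,v+1)-2$.
   Context: An RT poset $\Omega[m,s]$ is a poset on $ms$ elements that is a disjoint union of $m$ chains (blocks) of $s$ elements each, elements in different blocks being incomparable. An anti-ideal is the complement of an ideal (down-closed subset). For positive integers $t,m,s,v,\lambda,N$ with $2\le t\le ms$, an $OCA_{\lambda}(N;t,m,s,v)$ is an $N\times ms$ array with entries from an alphabet of size $v$ whose columns are labeled by the elements of an RT poset $\Omega[m,s]$, such that for every anti-ideal $J$ with $|J|=t$, the $N\times t$ subarray formed by the columns labeled by $J$ contains every $t$-tuple over the alphabet as a row at least $\lambda$ times. $OCAN_{\lambda}(t,m,s,v)$ is the smallest $N$ for which an $OCA_{\lambda}(N;t,m,s,v)$ exists. -}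

module Defs where

open import Data.Nat using (ℕ; _≤_)
open import Data.Fin using (Fin) renaming (_≤_ to _≤ᶠ_)
open import Data.Fin.Subset using (Subset; _∈_; ∣_∣)
open import Data.List using (List; map; allFin)
open import Data.Nat.ListAction using (sum)
open import Data.Product using (Σ; _×_)
open import Function.Definitions using (Injective)
open import Relation.Binary.PropositionalEquality using (_≡_)

-- The RT poset Ω[m,s]: elements are pairs (i , j) with i : Fin m the block
-- and j : Fin s the position in the chain of block i; (i , j) ≤ (i' , j')
-- iff i = i' and j ≤ j'.

RTSubset : ℕ → ℕ → Set
RTSubset m s = Fin m → Subset s

card : {m s : ℕ} → RTSubset m s → ℕ
card {m} J = sum (map (λ i → ∣ J i ∣) (allFin m))

IsAntiIdeal : {m s : ℕ} → RTSubset m s → Set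
IsAntiIdeal {m} {s} J =
  (i : Fin m) (j j' : Fin s) → j ≤ᶠ j' → j ∈ J i → j' ∈ J i

-- An N × ms array over alphabet Fin v, columns labelled by Ω[m,s].
Array : ℕ → ℕ → ℕ → ℕ → Set
Array N m s v = Fin N → Fin m → Fin s → Fin v

-- row r of A restricted to the columns in J equals the tuple τ
-- (τ assigns a symbol to every column; only its values on J matter,
--  so quantifying over all τ is quantifying over all |J|-tuples)
RowMatches : {N m s v : ℕ} → Array N m s v → RTSubset m s →
             (Fin m → Fin s → Fin v) → Fin N → Set
RowMatches {m = m} {s} A J τ r =
  (i : Fin m) (j : Fin s) → j ∈ J i → A r i j ≡ τ i j

IsOCA : (λ' N t m s v : ℕ) → Array N m s v → Set
IsOCA λ' N t m s v A =
  (J : RTSubset m s) → IsAntiIdeal J → card J ≡ t →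
  (τ : Fin m → Fin s → Fin v) →
  Σ (Fin λ' → Fin N) λ f → Injective _≡_ _≡_ f × ((k : Fin λ') → RowMatches A J τ (f k))

OCAExists : (λ' N t m s v : ℕ) → Set
OCAExists λ' N t m s v = Σ (Array N m s v) (IsOCA λ' N t m s v)

IsOCAN : (λ' t m s v n : ℕ) → Set
IsOCAN λ' t m s v n =
  OCAExists λ' n t m s v × ((N : ℕ) → OCAExists λ' N t m s v → n ≤ N)

{-# OPTIONS --safe #-}
module Submission where

-- From an OCA over v + 1 symbols, pick two distinct rows r₁, r₂ (they exist:
-- the constant tuples 0 and 1 must be covered) and delete them, merging in
-- each column c the symbol A r₁ c into A r₂ c.  Given a target τ over v
-- symbols, lift it avoiding A r₁ c in every column.  If row r₂ does not cover
-- the lift, the rows that do are neither r₁ nor r₂ and survive.  If it does,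
-- change the lift at one point p of the anti-ideal to A r₁ p: now r₂ fails at
-- p, r₁ fails at a second point (t ≥ 2), and merging still sends the new
-- symbol to τ p.  Either way λ covering rows survive the deletion.

open import Defs
open import Data.Nat using (ℕ; zero; suc; _+_; _*_; _∸_; _⊓_; _≤_; _<?_; z≤n; s≤s)
import Data.Nat.Properties as ℕP
import Data.Fin as F
open F using (Fin; punchIn; punchOut; toℕ)
open import Data.Fin.Properties as FP
  using (_≟_; punchInᵢ≢i; punchOut-cong; punchOut-punchIn; punchOut-injective; punchIn-punchOut; any?; all?)
open import Data.Fin.Subset using (Subset; inside; outside; _∈_; ∣_∣; ⁅_⁆; _⊆_; Empty)
open import Data.Fin.Subset.Properties using (_∈?_; nonempty?; Empty-unique; ∣⊥∣≡0; x∈⁅x⁆; p⊆q⇒∣p∣≤∣q∣; ∣⁅x⁆∣≡1)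
open import Data.List.Properties using (map-tabulate)
open import Data.Nat.ListAction using (sum)
open import Data.Vec using ([]; _∷_; here; there)
open import Data.Product using (Σ; ∃; _×_; _,_; proj₁; proj₂)
open import Data.Product.Properties using (≡-dec)
open import Data.Sum using (_⊎_; inj₁; inj₂)
open import Data.Empty using (⊥-elim)
open import Function using (_∘_)
open import Function.Definitions using (Injective)
open import Relation.Binary.Definitions using (DecidableEquality)
open import Relation.Nullary using (Dec; yes; no; ¬_)
open import Relation.Nullary.Decidable using (_×-dec_; _→-dec_; ¬?)
open import Relation.Binary.PropositionalEquality

Point : ℕ → ℕ → Set
Point m s = Fin m × Fin s

_∈ᴿ_ : ∀ {m s} → Point m s → RTSubset m s → Set
(i , j) ∈ᴿ J = j ∈ J i

_≟ᴾ_ : ∀ {m s} → DecidableEquality (Point m s)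
_≟ᴾ_ = ≡-dec _≟_ _≟_

Target : ℕ → ℕ → ℕ → Set
Target m s v = Fin m → Fin s → Fin v

Covers : ∀ {N m s v} → ℕ → Array N m s v → RTSubset m s → Target m s v → Set
Covers {N} λ' A J τ = Σ (Fin λ' → Fin N) λ f → Injective _≡_ _≡_ f × ((k : Fin λ') → RowMatches A J τ (f k))

card-suc : ∀ {m s} (J : RTSubset (suc m) s) → card J ≡ ∣ J F.zero ∣ + card (J ∘ F.suc)
card-suc J = cong (∣ J F.zero ∣ +_) (cong sum
  (trans (map-tabulate F.suc (λ i → ∣ J i ∣)) (sym (map-tabulate (λ i → i) (λ i → ∣ J (F.suc i) ∣)))))

∣Empty∣≡0 : ∀ {s} {p : Subset s} → Empty p → ∣ p ∣ ≡ 0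
∣Empty∣≡0 {s} e = trans (cong ∣_∣ (Empty-unique e)) (∣⊥∣≡0 s)

card-blocks-empty : ∀ {m s} (J : RTSubset m s) → (∀ i → ∣ J i ∣ ≡ 0) → card J ≡ 0
card-blocks-empty {zero} J _ = refl
card-blocks-empty {suc m} J h =
  trans (card-suc J) (cong₂ _+_ (h F.zero) (card-blocks-empty (J ∘ F.suc) (h ∘ F.suc)))

card-single-block : ∀ {m s} (J : RTSubset m s) (i₀ : Fin m) →
  (∀ i → i ≢ i₀ → ∣ J i ∣ ≡ 0) → card J ≡ ∣ J i₀ ∣
card-single-block {suc m} J F.zero h = begin
  card J                             ≡⟨ card-suc J ⟩
  ∣ J F.zero ∣ + card (J ∘ F.suc)     ≡⟨ cong (∣ J F.zero ∣ +_) (card-blocks-empty (J ∘ F.suc) (λ i → h (F.suc i) λ ())) ⟩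
  ∣ J F.zero ∣ + 0                    ≡⟨ ℕP.+-identityʳ _ ⟩
  ∣ J F.zero ∣                        ∎
  where open ≡-Reasoning
card-single-block {suc m} J (F.suc i₀) h = begin
  card J                             ≡⟨ card-suc J ⟩
  ∣ J F.zero ∣ + card (J ∘ F.suc)     ≡⟨ cong (_+ card (J ∘ F.suc)) (h F.zero λ ()) ⟩
  card (J ∘ F.suc)                   ≡⟨ card-single-block (J ∘ F.suc) i₀ (λ i i≢i₀ → h (F.suc i) (i≢i₀ ∘ FP.suc-injective)) ⟩
  ∣ J (F.suc i₀) ∣                    ∎
  where open ≡-Reasoning

point-of-card≥1 : ∀ {m s} (J : RTSubset m s) → 1 ≤ card J → ∃ λ p → p ∈ᴿ J
point-of-card≥1 J 1≤∣J∣ with any? (λ i → nonempty? (J i))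
... | yes (i , j , j∈Ji) = (i , j) , j∈Ji
... | no ∄ = ⊥-elim (ℕP.<⇒≢ 1≤∣J∣ (sym (card-blocks-empty J λ i → ∣Empty∣≡0 λ x → ∄ (i , x))))

other-point-of-card≥2 : ∀ {m s} (J : RTSubset m s) → 2 ≤ card J → (p : Point m s) →
  ∃ λ q → q ∈ᴿ J × q ≢ p
other-point-of-card≥2 J 2≤∣J∣ (i₀ , j₀) with any? (λ i → any? (λ j → (j ∈? J i) ×-dec ¬? ((i , j) ≟ᴾ (i₀ , j₀))))
... | yes (i , j , j∈Ji , q≢p) = (i , j) , j∈Ji , q≢p
... | no ∄ = ⊥-elim (ℕP.<⇒≱ 2≤∣J∣ ∣J∣≤1)
  where
  others-empty : ∀ i → i ≢ i₀ → ∣ J i ∣ ≡ 0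
  others-empty i i≢i₀ = ∣Empty∣≡0 λ { (j , j∈Ji) → ∄ (i , j , j∈Ji , i≢i₀ ∘ cong proj₁) }
  J-i₀⊆⁅j₀⁆ : J i₀ ⊆ ⁅ j₀ ⁆
  J-i₀⊆⁅j₀⁆ {j} j∈ with j ≟ j₀
  ... | yes refl = x∈⁅x⁆ j₀
  ... | no j≢j₀ = ⊥-elim (∄ (i₀ , j , j∈ , j≢j₀ ∘ cong proj₂))
  ∣J∣≤1 : card J ≤ 1
  ∣J∣≤1 = begin
    card J      ≡⟨ card-single-block J i₀ others-empty ⟩
    ∣ J i₀ ∣     ≤⟨ p⊆q⇒∣p∣≤∣q∣ J-i₀⊆⁅j₀⁆ ⟩
    ∣ ⁅ j₀ ⁆ ∣   ≡⟨ ∣⁅x⁆∣≡1 j₀ ⟩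
    1           ∎
    where open ℕP.≤-Reasoning

topSegment : (s k : ℕ) → Subset s
topSegment zero k = []
topSegment (suc s) k with s <? k
... | yes _ = inside ∷ topSegment s k
... | no _ = outside ∷ topSegment s k

∣topSegment∣ : ∀ s k → ∣ topSegment s k ∣ ≡ s ⊓ k
∣topSegment∣ zero k = refl
∣topSegment∣ (suc s) k with s <? k
... | yes s<k = trans (cong suc (trans (∣topSegment∣ s k) (ℕP.m≤n⇒m⊓n≡m (ℕP.<⇒≤ s<k)))) (sym (ℕP.m≤n⇒m⊓n≡m s<k))
... | no s≮k = trans (∣topSegment∣ s k) (trans (ℕP.m≥n⇒m⊓n≡n k≤s) (sym (ℕP.m≥n⇒m⊓n≡n (ℕP.m≤n⇒m≤1+n k≤s))))
  where k≤s = ℕP.≮⇒≥ s≮k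

topSegment-full : ∀ s k → s ≤ k → (j : Fin s) → j ∈ topSegment s k
topSegment-full (suc s) k s<k j with s <? k
topSegment-full (suc s) k s<k F.zero    | yes _ = here
topSegment-full (suc s) k s<k (F.suc j) | yes _ = there (topSegment-full s k (ℕP.<⇒≤ s<k) j)
... | no s≮k = ⊥-elim (s≮k s<k)

topSegment-up-closed : ∀ s k (j j' : Fin s) → toℕ j ≤ toℕ j' → j ∈ topSegment s k → j' ∈ topSegment s k
topSegment-up-closed (suc s) k j j' j≤j' j∈ with s <? k
topSegment-up-closed (suc s) k j F.zero j≤j' j∈ | yes _ = here
topSegment-up-closed (suc s) k j (F.suc j') j≤j' j∈ | yes s<k = there (topSegment-full s k (ℕP.<⇒≤ s<k) j')
topSegment-up-closed (suc s) k F.zero j' j≤j' () | no _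
topSegment-up-closed (suc s) k (F.suc j) F.zero () j∈ | no _
topSegment-up-closed (suc s) k (F.suc j) (F.suc j') (s≤s j≤j') (there j∈) | no _ =
  there (topSegment-up-closed s k j j' j≤j' j∈)

greedyAntiIdeal : (m s t : ℕ) → RTSubset m s
greedyAntiIdeal (suc m) s t F.zero    = topSegment s t
greedyAntiIdeal (suc m) s t (F.suc i) = greedyAntiIdeal m s (t ∸ s) i

greedyAntiIdeal-isAntiIdeal : ∀ m s t → IsAntiIdeal (greedyAntiIdeal m s t)
greedyAntiIdeal-isAntiIdeal (suc m) s t F.zero    = topSegment-up-closed s t
greedyAntiIdeal-isAntiIdeal (suc m) s t (F.suc i) = greedyAntiIdeal-isAntiIdeal m s (t ∸ s) i

greedyAntiIdeal-card : ∀ m s t → t ≤ m * s → card (greedyAntiIdeal m s t) ≡ t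
greedyAntiIdeal-card zero s zero _ = refl
greedyAntiIdeal-card (suc m) s t t≤ms = begin
  card (greedyAntiIdeal (suc m) s t)           ≡⟨ card-suc (greedyAntiIdeal (suc m) s t) ⟩
  ∣ topSegment s t ∣ + card (greedyAntiIdeal m s (t ∸ s)) ≡⟨ cong₂ _+_ (∣topSegment∣ s t) (greedyAntiIdeal-card m s (t ∸ s) (ℕP.m≤n+o⇒m∸n≤o t s t≤ms)) ⟩
  s ⊓ t + (t ∸ s)                              ≡⟨ split (ℕP.≤-total t s) ⟩
  t                                            ∎
  where
  open ≡-Reasoning
  split : t ≤ s ⊎ s ≤ t → s ⊓ t + (t ∸ s) ≡ t
  split (inj₁ t≤s) = trans (cong₂ _+_ (ℕP.m≥n⇒m⊓n≡n t≤s) (ℕP.m≤n⇒m∸n≡0 t≤s)) (ℕP.+-identityʳ t)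
  split (inj₂ s≤t) = trans (cong (_+ (t ∸ s)) (ℕP.m≤n⇒m⊓n≡m s≤t)) (ℕP.m+[n∸m]≡n s≤t)

RowMatches? : ∀ {N m s v} (A : Array N m s v) J τ r → Dec (RowMatches A J τ r)
RowMatches? A J τ r = all? λ i → all? λ j → (j ∈? J i) →-dec (A r i j ≟ τ i j)

-- merge a b sends a to the new name of b and renumbers the other symbols
-- with a removed; F.zero is a junk value used only when a ≡ b.
merge : ∀ {w} (a b x : Fin (suc (suc w))) → Fin (suc w)
merge a b x with a ≟ x
... | no a≢x = punchOut a≢x
... | yes _ with a ≟ b
...   | yes _ = F.zero
...   | no a≢b = punchOut a≢b

merge-punchIn : ∀ {w} (a b : Fin (suc (suc w))) y → merge a b (punchIn a y) ≡ y
merge-punchIn a b y with a ≟ punchIn a y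
... | yes a≡ = ⊥-elim (punchInᵢ≢i a y (sym a≡))
... | no _ = trans (punchOut-cong a refl) (punchOut-punchIn a)

merge-self : ∀ {w} (a b : Fin (suc (suc w))) y → b ≡ punchIn a y → merge a b a ≡ y
merge-self a b y b≡ with a ≟ a
... | no a≢a = ⊥-elim (a≢a refl)
... | yes _ with a ≟ b
...   | yes a≡b = ⊥-elim (punchInᵢ≢i a y (sym (trans a≡b b≡)))
...   | no _ = trans (punchOut-cong a b≡) (punchOut-punchIn a)

module Fusion {N m s w λ' t : ℕ} (A : Array (suc (suc N)) m s (suc (suc w)))
  (isOCA : IsOCA λ' (suc (suc N)) t m s (suc (suc w)) A)
  (r₁ r₂ : Fin (suc (suc N))) (r₁≢r₂ : r₁ ≢ r₂) where

  collapse : Fin m → Fin s → Fin (suc (suc w)) → Fin (suc w)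
  collapse i j = merge (A r₁ i j) (A r₂ i j)

  remaining : Fin N → Fin (suc (suc N))
  remaining k = punchIn r₁ (punchIn (punchOut r₁≢r₂) k)

  remaining-surjective : (r : Fin (suc (suc N))) → r₁ ≢ r → r₂ ≢ r → ∃ λ k → remaining k ≡ r
  remaining-surjective r r₁≢r r₂≢r = punchOut r₂'≢r' ,
    trans (cong (punchIn r₁) (punchIn-punchOut r₂'≢r')) (punchIn-punchOut r₁≢r)
    where
    r₂'≢r' : punchOut r₁≢r₂ ≢ punchOut r₁≢r
    r₂'≢r' = r₂≢r ∘ punchOut-injective r₁≢r₂ r₁≢r

  fused : Array N m s (suc w)
  fused k i j = collapse i j (A (remaining k) i j)

  -- The rows of A covering τ' are neither r₁ nor r₂, so they survive in the
  -- fused array, where they cover τ.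
  record Lift (J : RTSubset m s) (τ : Target m s (suc w)) (τ' : Target m s (suc (suc w))) : Set where
    field
      avoids₁ : ∀ r → RowMatches A J τ' r → r₁ ≢ r
      avoids₂ : ∀ r → RowMatches A J τ' r → r₂ ≢ r
      collapses : ∀ i j → j ∈ J i → collapse i j (τ' i j) ≡ τ i j

  lift-rows : ∀ {J τ τ'} → IsAntiIdeal J → card J ≡ t → Lift J τ τ' → Covers λ' fused J τ
  lift-rows {J} {τ} {τ'} anti ∣J∣≡t lift with isOCA J anti ∣J∣≡t τ'
  ... | f , f-injective , f-matches = g , g-injective , g-matches
    where
    open Lift lift
    preimage : ∀ k → ∃ λ l → remaining l ≡ f k
    preimage k = remaining-surjective (f k) (avoids₁ (f k) (f-matches k)) (avoids₂ (f k) (f-matches k))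
    g : Fin λ' → Fin N
    g = proj₁ ∘ preimage
    g-injective : Injective _≡_ _≡_ g
    g-injective {k} {k'} gk≡gk' =
      f-injective (trans (sym (proj₂ (preimage k))) (trans (cong remaining gk≡gk') (proj₂ (preimage k'))))
    g-matches : (k : Fin λ') → RowMatches fused J τ (g k)
    g-matches k i j j∈ = begin
      collapse i j (A (remaining (g k)) i j) ≡⟨ cong (λ r → collapse i j (A r i j)) (proj₂ (preimage k)) ⟩
      collapse i j (A (f k) i j)            ≡⟨ cong (collapse i j) (f-matches k i j j∈) ⟩
      collapse i j (τ' i j)                 ≡⟨ collapses i j j∈ ⟩
      τ i j                                 ∎
      where open ≡-Reasoning

  avoiding : Target m s (suc w) → Target m s (suc (suc w))
  avoiding τ i j = punchIn (A r₁ i j) (τ i j)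

  lift-avoiding : ∀ {J τ p} → p ∈ᴿ J → ¬ RowMatches A J (avoiding τ) r₂ → Lift J τ (avoiding τ)
  lift-avoiding {J} {τ} {i₀ , j₀} p∈J ¬r₂ = record
    { avoids₁ = λ r matches r₁≡r →
        punchInᵢ≢i (A r₁ i₀ j₀) (τ i₀ j₀) (sym (trans (cong (λ r → A r i₀ j₀) r₁≡r) (matches i₀ j₀ p∈J)))
    ; avoids₂ = λ r matches r₂≡r → ¬r₂ (subst (RowMatches A J (avoiding τ)) (sym r₂≡r) matches)
    ; collapses = λ i j _ → merge-punchIn (A r₁ i j) (A r₂ i j) (τ i j)
    }

  redirect : Point m s → Target m s (suc w) → Target m s (suc (suc w))
  redirect p τ i j with (i , j) ≟ᴾ p
  ... | yes _ = A r₁ i j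
  ... | no _ = avoiding τ i j

  -- When r₂ matches the avoiding target, ask at p for the symbol of r₁, which
  -- r₂ does not carry there and which merges into τ; r₁ is excluded at q.
  lift-redirect : ∀ {J τ p q} → p ∈ᴿ J → q ∈ᴿ J → q ≢ p →
    RowMatches A J (avoiding τ) r₂ → Lift J τ (redirect p τ)
  lift-redirect {J} {τ} {p} {q} p∈J q∈J q≢p r₂-matches = record
    { avoids₁ = avoids₁ ; avoids₂ = avoids₂ ; collapses = collapses }
    where
    avoids₁ : ∀ r → RowMatches A J (redirect p τ) r → r₁ ≢ r
    avoids₁ r matches r₁≡r with (proj₁ q , proj₂ q) ≟ᴾ p | matches (proj₁ q) (proj₂ q) q∈J
    ... | yes q≡p | _ = q≢p q≡p
    ... | no _ | Ar≡ = punchInᵢ≢i (A r₁ _ _) (τ _ _) (sym (trans (cong (λ r → A r _ _) r₁≡r) Ar≡))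
    avoids₂ : ∀ r → RowMatches A J (redirect p τ) r → r₂ ≢ r
    avoids₂ r matches r₂≡r with (proj₁ p , proj₂ p) ≟ᴾ p | matches (proj₁ p) (proj₂ p) p∈J
    ... | no p≢p | _ = p≢p refl
    ... | yes _ | Ar≡ = punchInᵢ≢i (A r₁ _ _) (τ _ _)
            (trans (sym (r₂-matches _ _ p∈J)) (trans (cong (λ r → A r _ _) r₂≡r) Ar≡))
    collapses : ∀ i j → j ∈ J i → collapse i j (redirect p τ i j) ≡ τ i j
    collapses i j j∈ with (i , j) ≟ᴾ p
    ... | no _ = merge-punchIn (A r₁ i j) (A r₂ i j) (τ i j)
    ... | yes refl = merge-self (A r₁ i j) (A r₂ i j) (τ i j) (r₂-matches i j j∈)

  fused-covers : ∀ {J} → IsAntiIdeal J → card J ≡ t → 2 ≤ card J → ∀ τ → Covers λ' fused J τ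
  fused-covers {J} anti ∣J∣≡t 2≤∣J∣ τ with point-of-card≥1 J (ℕP.≤-trans (s≤s z≤n) 2≤∣J∣)
  ... | p , p∈J with RowMatches? A J (avoiding τ) r₂
  ...   | no ¬r₂ = lift-rows anti ∣J∣≡t (lift-avoiding p∈J ¬r₂)
  ...   | yes r₂-matches with other-point-of-card≥2 J 2≤∣J∣ p
  ...     | q , q∈J , q≢p = lift-rows anti ∣J∣≡t (lift-redirect p∈J q∈J q≢p r₂-matches)

  fused-isOCA : 2 ≤ t → IsOCA λ' N t m s (suc w) fused
  fused-isOCA 2≤t J anti ∣J∣≡t = fused-covers anti ∣J∣≡t (subst (2 ≤_) (sym ∣J∣≡t) 2≤t)

fusion : ∀ {λ' n' t m s w} → 2 ≤ t → (A : Array n' m s (suc (suc w))) → IsOCA λ' n' t m s (suc (suc w)) A →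
  (r₁ r₂ : Fin n') → r₁ ≢ r₂ → ∃ λ N → N + 2 ≡ n' × OCAExists λ' N t m s (suc w)
fusion {n' = suc (suc N)} 2≤t A isOCA r₁ r₂ r₁≢r₂ =
  N , ℕP.+-comm N 2 , fused , fused-isOCA 2≤t
  where open Fusion A isOCA r₁ r₂ r₁≢r₂
fusion {n' = suc zero} 2≤t A isOCA F.zero F.zero r₁≢r₂ = ⊥-elim (r₁≢r₂ refl)

-- The rows covering the constant tuples 0 and 1 on a nonempty anti-ideal.
two-distinct-rows : ∀ {λ' n t m s w} → 1 ≤ λ' → 1 ≤ t → t ≤ m * s →
  (A : Array n m s (suc (suc w))) → IsOCA λ' n t m s (suc (suc w)) A →
  Σ (Fin n) λ r₁ → Σ (Fin n) λ r₂ → r₁ ≢ r₂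
two-distinct-rows {suc λ'} {n} {t} {m} {s} {w} _ 1≤t t≤ms A isOCA = row₀ , row₁ , row₀≢row₁
  where
  J₀ : RTSubset m s
  J₀ = greedyAntiIdeal m s t
  ∣J₀∣≡t : card J₀ ≡ t
  ∣J₀∣≡t = greedyAntiIdeal-card m s t t≤ms
  covering : (τ : Target m s (suc (suc w))) → Covers (suc λ') A J₀ τ
  covering = isOCA J₀ (greedyAntiIdeal-isAntiIdeal m s t) ∣J₀∣≡t
  point : ∃ λ p → p ∈ᴿ J₀
  point = point-of-card≥1 J₀ (subst (1 ≤_) (sym ∣J₀∣≡t) 1≤t)
  row₀ row₁ : Fin n
  row₀ = proj₁ (covering (λ _ _ → F.zero)) F.zero
  row₁ = proj₁ (covering (λ _ _ → F.suc F.zero)) F.zero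
  row₀≢row₁ : row₀ ≢ row₁
  row₀≢row₁ row₀≡row₁ with point
  ... | (i , j) , j∈ with trans (sym (proj₂ (proj₂ (covering (λ _ _ → F.zero))) F.zero i j j∈))
    (trans (cong (λ r → A r i j) row₀≡row₁) (proj₂ (proj₂ (covering (λ _ _ → F.suc F.zero))) F.zero i j j∈))
  ... | ()

theorem1 : (t m s v λ' : ℕ) → 1 ≤ m → 1 ≤ s → 1 ≤ v → 1 ≤ λ' →
    2 ≤ t → t ≤ m * s →
    (n n' : ℕ) → IsOCAN λ' t m s v n → IsOCAN λ' t m s (suc v) n' →
    n + 2 ≤ n'
theorem1 t m s (suc w) λ' _ _ _ 1≤λ' 2≤t t≤ms n n' (_ , minimal) ((A , isOCA) , _)
  with two-distinct-rows 1≤λ' (ℕP.≤-trans (s≤s z≤n) 2≤t) t≤ms A isOCA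
... | r₁ , r₂ , r₁≢r₂ with fusion 2≤t A isOCA r₁ r₂ r₁≢r₂
...   | N , N+2≡n' , smaller = subst (n + 2 ≤_) N+2≡n' (ℕP.+-monoˡ-≤ 2 (minimal N smaller))
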